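{- For every $n\ge 3$, $f(n,3,\{\wedge_2,\vee_2,P_3\})=2^{n-2}$.
   Context: $B_n$ is the Boolean lattice $2^{[n]}$ ordered by inclusion. For a finite poset $P$, a family $\mathcal G\subseteq B_n$ is a (strong) copy of $P$ if there is a bijection $i:P\to\mathcal G$ with $p\le_P q$ if and only if $i(p)\subseteq i(q)$ (for $p\neq q$, strictly). For a partial coloring $c$ of $B_n$, a copy is rainbow if all its members are colored and receive pairwise distinct colors. For a positive integer $l$ and a family $\mathcal P$ of finite posets, $f(n,l,\mathcal P)$ is the maximum $m$ such that there exists a partial coloring $c$ of $B_n$ with colors from $[l]$ admitting no rainbow strong copy of any $P\in\mathcal P$ and with every color class $c^{ -1}(\{i\})$, $i\in[l]$, of size at least $m$. $P_3$ is the chain (totally ordered set) on $3$ elements; $\vee_2$ is the poset on elements $a,b_1,b_2$ with $a<b_1$, $a<b_2$ and $b_1,b_2$ incomparable; $\wedge_2$ is the poset on $a,b_1,b_2$ with $b_1<a$, $b_2<a$ and $b_1,b_2$ incomparable. -}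

module Defs where

open import Data.Nat using (ℕ; zero; suc; _≥_)
open import Data.Fin using (Fin; zero; suc; _≤_)
open import Data.Fin.Properties using () renaming (_≟_ to _≟F_)
open import Data.Fin.Subset using (Subset; _⊆_; inside; outside)
open import Data.Maybe using (Maybe; just; nothing)
open import Data.Maybe.Properties using () renaming (≡-dec to ≡-decM)
open import Data.List using (List; []; _∷_; _++_; map; filter; length)
open import Data.Vec using (Vec; []; _∷_)
open import Data.Product using (Σ; _×_; _,_)
open import Data.Sum using (_⊎_)
open import Function.Bundles using (_⇔_)
open import Relation.Nullary using (¬_)
open import Relation.Binary.PropositionalEquality using (_≡_; _≢_)

-- All members of the Boolean lattice B_n = 2^[n], elements encoded as
-- characteristic vectors (Data.Fin.Subset), ordered by ⊆.
allSubsets : (n : ℕ) → List (Subset n)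
allSubsets zero = [] ∷ []
allSubsets (suc n) = map (outside ∷_) (allSubsets n) ++ map (inside ∷_) (allSubsets n)

-- A partial l-coloring of B_n: nothing = uncolored.
Coloring : ℕ → ℕ → Set
Coloring n l = Subset n → Maybe (Fin l)

classSize : ∀ {n l} → Coloring n l → Fin l → ℕ
classSize {n} {l} c i = length (filter (λ s → ≡-decM _≟F_ (c s) (just i)) (allSubsets n))

-- A poset on k elements, given by its (reflexive) order relation on Fin k.
Poset : ℕ → Set₁
Poset k = Fin k → Fin k → Set

IsStrongCopy : ∀ {n k} → Poset k → (Fin k → Subset n) → Set
IsStrongCopy {k = k} P i =
  (∀ p q → i p ≡ i q → p ≡ q) ×
  (∀ (p q : Fin k) → p ≢ q → (P p q ⇔ (i p ⊆ i q)))

IsRainbow : ∀ {n l k} → Coloring n l → (Fin k → Subset n) → Set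
IsRainbow {l = l} {k = k} c i =
  Σ (Fin k → Fin l) λ κ → (∀ p → c (i p) ≡ just (κ p)) × (∀ p q → κ p ≡ κ q → p ≡ q)

HasRainbowCopy : ∀ {n l k} → Coloring n l → Poset k → Set
HasRainbowCopy {n} {k = k} c P = Σ (Fin k → Subset n) λ i → IsStrongCopy P i × IsRainbow c i

P3 : Poset 3
P3 p q = p ≤ q

vee2 : Poset 3
vee2 p q = p ≡ q ⊎ p ≡ zero

wedge2 : Poset 3
wedge2 p q = p ≡ q ⊎ q ≡ zero

Admissible : (n l m : ℕ) → Set
Admissible n l m =
  Σ (Coloring n l) λ c →
    ¬ HasRainbowCopy c wedge2 × ¬ HasRainbowCopy c vee2 × ¬ HasRainbowCopy c P3 ×
    (∀ i → classSize c i ≥ m)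

-- "f(n,l,{∧₂,∨₂,P₃}) = v": v is the maximum m with Admissible n l m.
fIs : (n l v : ℕ) → Set
fIs n l v = Admissible n l v × (∀ m → Admissible n l m → m Data.Nat.≤ v)

module Submission where

-- Call a coloured set x together with sets y, z of the two other colours,
-- both comparable to x, a rainbow star.  Sorting x, y, z by inclusion gives a
-- rainbow chain, ∨₂ or ∧₂ (star-copy), and every rainbow copy of the three
-- posets is such a star (chain-star, vee-star, wedge-star); so the admissible
-- colourings are exactly those without rainbow stars.
--
-- Upper bound.  For G ⊆ B_n let isolated G be the sets comparable to no member
-- of G.  Without rainbow stars each coloured set is isolated from one of the
-- two other colour classes, so Σⱼ |Cⱼ| ≤ Σⱼ |isolated Cⱼ|.  The Harris–Kleitman
-- inequality (an up-set and a down-set are negatively correlated), applied to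
-- the up- and down-closures of G and to their complements, gives
-- 16 |G| |isolated G| ≤ 4^n; so a class with more than 2^(n-2) members leaves
-- at most 2^(n-2) sets isolated, and three such classes are impossible.
--
-- Lower bound.  Colour a set by its first three coordinates: colour i when
-- i is in it but the cyclic predecessor of i is not.  Comparable sets of
-- cyclically consecutive colours are then ordered, which rules out stars, and
-- every colour class has 2 · 2^(n-3) members.

open import Defs
open import Data.Nat using (ℕ; zero; suc; _+_; _*_; _∸_; _^_; _≤_; _<_; _≥_; z≤n; s≤s; _≤?_; >-nonZero)
open import Data.Nat.Properties
open import Data.Nat.Tactic.RingSolver using (solve-∀)
open import Data.Bool using (Bool; true; false; T; T?; not; _∧_; _∨_)
open import Data.Bool.Properties using (T-∧; T-∨)
open import Data.Fin using (Fin; zero; suc; #_)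
open import Data.Fin.Subset using (Subset; _⊆_; _∈_; inside; outside)
open import Data.Fin.Subset.Properties using (out⊆; in⊆in; drop-∷-⊆; ⊆-refl; ⊆-trans; ⊆-antisym; _⊆?_)
open import Data.List using (List; []; _∷_; _++_; map; filter; length)
open import Data.List.Properties using (length-++; filter-++)
open import Data.Vec using ([]; _∷_; take; here; there)
open import Data.Product using (Σ; _×_; _,_)
open import Data.Sum using (_⊎_; inj₁; inj₂; [_,_])
open import Data.Empty using (⊥; ⊥-elim)
open import Function using (_∘_; flip)
open import Function.Bundles using (Equivalence; _⇔_; mk⇔)
open import Data.Maybe using (Maybe; just; nothing)
open import Data.Maybe.Properties using (just-injective) renaming (≡-dec to ≡-decMaybe)
open import Data.Fin.Properties using () renaming (_≟_ to _≟ᶠ_)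
open import Relation.Nullary using (¬_; Dec; yes; no; does)
open import Relation.Unary using (Pred; Decidable)
open import Relation.Binary.PropositionalEquality
  using (_≡_; _≢_; refl; sym; trans; cong; cong₂; subst; subst₂; module ≡-Reasoning)

open Equivalence using (to; from)

-- Σ_{x ∈ B_n} f x, splitting on the first coordinate exactly as allSubsets does.
sumS : ∀ n → (Subset n → ℕ) → ℕ
sumS zero    f = f []
sumS (suc n) f = sumS n (f ∘ (outside ∷_)) + sumS n (f ∘ (inside ∷_))

sumS-mono : ∀ n {f g : Subset n → ℕ} → (∀ x → f x ≤ g x) → sumS n f ≤ sumS n g
sumS-mono zero    f≤g = f≤g []
sumS-mono (suc n) f≤g = +-mono-≤ (sumS-mono n (f≤g ∘ (outside ∷_))) (sumS-mono n (f≤g ∘ (inside ∷_)))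

sumS-cong : ∀ n {f g : Subset n → ℕ} → (∀ x → f x ≡ g x) → sumS n f ≡ sumS n g
sumS-cong n f≗g = ≤-antisym (sumS-mono n (≤-reflexive ∘ f≗g)) (sumS-mono n (≤-reflexive ∘ sym ∘ f≗g))

sumS-+ : ∀ n (f g : Subset n → ℕ) → sumS n (λ x → f x + g x) ≡ sumS n f + sumS n g
sumS-+ zero    f g = refl
sumS-+ (suc n) f g =
  begin
    sumS n (λ x → f (outside ∷ x) + g (outside ∷ x)) + sumS n (λ x → f (inside ∷ x) + g (inside ∷ x))
  ≡⟨ cong₂ _+_ (sumS-+ n _ _) (sumS-+ n _ _) ⟩
    (f₀ + g₀) + (f₁ + g₁)
  ≡⟨ +-comm-middle f₀ g₀ f₁ g₁ ⟩
    (f₀ + f₁) + (g₀ + g₁)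
  ∎
  where
  open ≡-Reasoning
  f₀ = sumS n (f ∘ (outside ∷_)); f₁ = sumS n (f ∘ (inside ∷_))
  g₀ = sumS n (g ∘ (outside ∷_)); g₁ = sumS n (g ∘ (inside ∷_))
  +-comm-middle : ∀ a b c d → (a + b) + (c + d) ≡ (a + c) + (b + d)
  +-comm-middle = solve-∀

sumS-const : ∀ n v → sumS n (λ _ → v) ≡ v * 2 ^ n
sumS-const zero    v = sym (*-identityʳ v)
sumS-const (suc n) v = trans (cong₂ _+_ (sumS-const n v) (sumS-const n v)) (double v (2 ^ n))
  where
  double : ∀ v a → v * a + v * a ≡ v * (2 * a)
  double = solve-∀

sumS-take : ∀ m k (g : Subset m → ℕ) → sumS (m + k) (g ∘ take m) ≡ sumS m g * 2 ^ k
sumS-take zero    k g = sumS-const k (g [])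
sumS-take (suc m) k g =
  trans (cong₂ _+_ (sumS-take m k (g ∘ (outside ∷_))) (sumS-take m k (g ∘ (inside ∷_))))
        (sym (*-distribʳ-+ (2 ^ k) (sumS m (g ∘ (outside ∷_))) (sumS m (g ∘ (inside ∷_)))))

indicator : Bool → ℕ
indicator true  = 1
indicator false = 0

length-filter-map : ∀ {a b p} {A : Set a} {B : Set b} {P : Pred B p} (P? : Decidable P)
  (f : A → B) (xs : List A) →
  length (filter P? (map f xs)) ≡ length (filter (P? ∘ f) xs)
length-filter-map P? f []       = refl
length-filter-map P? f (x ∷ xs) with does (P? (f x))
... | true  = cong suc (length-filter-map P? f xs)
... | false = length-filter-map P? f xs

count-as-sum : ∀ {p} n {P : Pred (Subset n) p} (P? : Decidable P) →
  length (filter P? (allSubsets n)) ≡ sumS n (indicator ∘ does ∘ P?)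
count-as-sum zero P? with does (P? [])
... | true  = refl
... | false = refl
count-as-sum (suc n) P? =
  begin
    length (filter P? (outs ++ ins))
  ≡⟨ cong length (filter-++ P? outs ins) ⟩
    length (filter P? outs ++ filter P? ins)
  ≡⟨ length-++ (filter P? outs) ⟩
    length (filter P? outs) + length (filter P? ins)
  ≡⟨ cong₂ _+_ (trans (length-filter-map P? (outside ∷_) (allSubsets n)) (count-as-sum n (P? ∘ (outside ∷_))))
               (trans (length-filter-map P? (inside ∷_) (allSubsets n)) (count-as-sum n (P? ∘ (inside ∷_)))) ⟩
    sumS (suc n) (indicator ∘ does ∘ P?)
  ∎
  where
  open ≡-Reasoning
  outs = map (outside ∷_) (allSubsets n)
  ins  = map (inside ∷_) (allSubsets n)

Fam : ℕ → Set
Fam n = Subset n → Bool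

size : ∀ n → Fam n → ℕ
size n U = sumS n (indicator ∘ U)

indicator-mono : ∀ {a b} → (T a → T b) → indicator a ≤ indicator b
indicator-mono {false}         a⇒b = z≤n
indicator-mono {true}  {true}  a⇒b = ≤-refl
indicator-mono {true}  {false} a⇒b = ⊥-elim (a⇒b _)

size-mono : ∀ n {U V : Fam n} → (∀ x → T (U x) → T (V x)) → size n U ≤ size n V
size-mono n U⇒V = sumS-mono n (λ x → indicator-mono (U⇒V x))

size-complement : ∀ n (U : Fam n) → size n U + size n (not ∘ U) ≡ 2 ^ n
size-complement n U =
  begin
    size n U + size n (not ∘ U)                      ≡⟨ sym (sumS-+ n _ _) ⟩
    sumS n (λ x → indicator (U x) + indicator (not (U x))) ≡⟨ sumS-cong n (λ x → one (U x)) ⟩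
    sumS n (λ _ → 1)                                  ≡⟨ sumS-const n 1 ⟩
    1 * 2 ^ n                                         ≡⟨ *-identityˡ (2 ^ n) ⟩
    2 ^ n
  ∎
  where
  open ≡-Reasoning
  one : ∀ b → indicator b + indicator (not b) ≡ 1
  one true  = refl
  one false = refl

not-intro : ∀ {b} → ¬ T b → T (not b)
not-intro {true}  ¬b = ¬b _
not-intro {false} ¬b = _

not-elim : ∀ {b} → T (not b) → ¬ T b
not-elim {true} () _

IsUp : ∀ {n} → Fam n → Set
IsUp {n} U = ∀ (x y : Subset n) → x ⊆ y → T (U x) → T (U y)

IsDown : ∀ {n} → Fam n → Set
IsDown {n} D = ∀ (x y : Subset n) → x ⊆ y → T (D y) → T (D x)

∷-mono-⊆ : ∀ {n} s {x y : Subset n} → x ⊆ y → s ∷ x ⊆ s ∷ y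
∷-mono-⊆ outside = out⊆
∷-mono-⊆ inside  = in⊆in

up-complement : ∀ {n} {U : Fam n} → IsUp U → IsDown (not ∘ U)
up-complement U-up x y x⊆y ¬Uy = not-intro (not-elim ¬Uy ∘ U-up x y x⊆y)

down-complement : ∀ {n} {D : Fam n} → IsDown D → IsUp (not ∘ D)
down-complement D-down x y x⊆y ¬Dx = not-intro (not-elim ¬Dx ∘ D-down x y x⊆y)

chebyshev₂ : ∀ u₀ u₁ d₀ d₁ → u₀ ≤ u₁ → d₁ ≤ d₀ →
  2 * (u₀ * d₀ + u₁ * d₁) ≤ (u₀ + u₁) * (d₀ + d₁)
chebyshev₂ u₀ u₁ d₀ d₁ u₀≤u₁ d₁≤d₀ with m≤n⇒∃[o]m+o≡n u₀≤u₁ | m≤n⇒∃[o]m+o≡n d₁≤d₀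
... | p , refl | q , refl = subst (2 * (u₀ * (d₁ + q) + (u₀ + p) * d₁) ≤_) (sym (expand u₀ p d₁ q)) (m≤m+n _ (p * q))
  where
  expand : ∀ u p d q → (u + (u + p)) * ((d + q) + d) ≡ 2 * (u * (d + q) + (u + p) * d) + p * q
  expand = solve-∀

harris-kleitman : ∀ n (U D : Fam n) → IsUp U → IsDown D →
  2 ^ n * size n (λ x → U x ∧ D x) ≤ size n U * size n D
harris-kleitman zero U D _ _ with U [] | D []
... | true  | true  = ≤-refl
... | true  | false = ≤-refl
... | false | _     = ≤-refl
harris-kleitman (suc n) U D U-up D-down =
  begin
    2 * 2 ^ n * (i₀ + i₁)          ≡⟨ distribute (2 ^ n) i₀ i₁ ⟩
    2 * (2 ^ n * i₀ + 2 ^ n * i₁)  ≤⟨ *-monoʳ-≤ 2 (+-mono-≤ on-outside on-inside) ⟩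
    2 * (u₀ * d₀ + u₁ * d₁)        ≤⟨ chebyshev₂ u₀ u₁ d₀ d₁ u₀≤u₁ d₁≤d₀ ⟩
    (u₀ + u₁) * (d₀ + d₁)
  ∎
  where
  open ≤-Reasoning
  U₀ = U ∘ (outside ∷_); U₁ = U ∘ (inside ∷_)
  D₀ = D ∘ (outside ∷_); D₁ = D ∘ (inside ∷_)
  i₀ = size n (λ x → U₀ x ∧ D₀ x); i₁ = size n (λ x → U₁ x ∧ D₁ x)
  u₀ = size n U₀; u₁ = size n U₁; d₀ = size n D₀; d₁ = size n D₁
  up-half : ∀ s → IsUp (U ∘ (s ∷_))
  up-half s x y x⊆y = U-up _ _ (∷-mono-⊆ s x⊆y)
  down-half : ∀ s → IsDown (D ∘ (s ∷_))
  down-half s x y x⊆y = D-down _ _ (∷-mono-⊆ s x⊆y)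
  on-outside : 2 ^ n * i₀ ≤ u₀ * d₀
  on-outside = harris-kleitman n U₀ D₀ (up-half outside) (down-half outside)
  on-inside : 2 ^ n * i₁ ≤ u₁ * d₁
  on-inside = harris-kleitman n U₁ D₁ (up-half inside) (down-half inside)
  u₀≤u₁ : u₀ ≤ u₁
  u₀≤u₁ = size-mono n (λ x → U-up _ _ (out⊆ ⊆-refl))
  d₁≤d₀ : d₁ ≤ d₀
  d₁≤d₀ = size-mono n (λ x → D-down _ _ (out⊆ ⊆-refl))
  distribute : ∀ a b c → 2 * a * (b + c) ≡ 2 * (a * b + a * c)
  distribute = solve-∀

-- up n G x holds iff some member of G lies below x (up-intro, up-elim).
up : ∀ n → Fam n → Fam n
up zero    G x             = G x
up (suc n) G (outside ∷ x) = up n (G ∘ (outside ∷_)) x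
up (suc n) G (inside ∷ x)  = up n (G ∘ (outside ∷_)) x ∨ up n (G ∘ (inside ∷_)) x

-- down n G x holds iff some member of G lies above x (down-intro, down-elim).
down : ∀ n → Fam n → Fam n
down zero    G x             = G x
down (suc n) G (outside ∷ x) = down n (G ∘ (outside ∷_)) x ∨ down n (G ∘ (inside ∷_)) x
down (suc n) G (inside ∷ x)  = down n (G ∘ (inside ∷_)) x

zero∉outside∷ : ∀ {n} {x : Subset n} → ¬ (zero ∈ outside ∷ x)
zero∉outside∷ ()

up-intro : ∀ n G (z x : Subset n) → T (G z) → z ⊆ x → T (up n G x)
up-intro zero    G []            []            Gz _   = Gz
up-intro (suc n) G (outside ∷ z) (outside ∷ x) Gz z⊆x = up-intro n _ z x Gz (drop-∷-⊆ z⊆x)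
up-intro (suc n) G (outside ∷ z) (inside ∷ x)  Gz z⊆x = from T-∨ (inj₁ (up-intro n _ z x Gz (drop-∷-⊆ z⊆x)))
up-intro (suc n) G (inside ∷ z)  (inside ∷ x)  Gz z⊆x = from T-∨ (inj₂ (up-intro n _ z x Gz (drop-∷-⊆ z⊆x)))
up-intro (suc n) G (inside ∷ z)  (outside ∷ x) Gz z⊆x = ⊥-elim (zero∉outside∷ (z⊆x here))

up-elim : ∀ n G (x : Subset n) → T (up n G x) → Σ (Subset n) λ z → T (G z) × z ⊆ x
up-elim zero G [] Gx = [] , Gx , ⊆-refl
up-elim (suc n) G (outside ∷ x) up-x with up-elim n _ x up-x
... | z , Gz , z⊆x = outside ∷ z , Gz , out⊆ z⊆x
up-elim (suc n) G (inside ∷ x) up-x with to T-∨ up-x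
... | inj₁ up₀ with up-elim n _ x up₀
...   | z , Gz , z⊆x = outside ∷ z , Gz , out⊆ z⊆x
up-elim (suc n) G (inside ∷ x) up-x | inj₂ up₁ with up-elim n _ x up₁
...   | z , Gz , z⊆x = inside ∷ z , Gz , in⊆in z⊆x

down-intro : ∀ n G (z x : Subset n) → T (G z) → x ⊆ z → T (down n G x)
down-intro zero    G []            []            Gz _   = Gz
down-intro (suc n) G (inside ∷ z)  (inside ∷ x)  Gz x⊆z = down-intro n _ z x Gz (drop-∷-⊆ x⊆z)
down-intro (suc n) G (outside ∷ z) (outside ∷ x) Gz x⊆z = from T-∨ (inj₁ (down-intro n _ z x Gz (drop-∷-⊆ x⊆z)))
down-intro (suc n) G (inside ∷ z)  (outside ∷ x) Gz x⊆z = from T-∨ (inj₂ (down-intro n _ z x Gz (drop-∷-⊆ x⊆z)))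
down-intro (suc n) G (outside ∷ z) (inside ∷ x)  Gz x⊆z = ⊥-elim (zero∉outside∷ (x⊆z here))

down-elim : ∀ n G (x : Subset n) → T (down n G x) → Σ (Subset n) λ z → T (G z) × x ⊆ z
down-elim zero G [] Gx = [] , Gx , ⊆-refl
down-elim (suc n) G (inside ∷ x) down-x with down-elim n _ x down-x
... | z , Gz , x⊆z = inside ∷ z , Gz , in⊆in x⊆z
down-elim (suc n) G (outside ∷ x) down-x with to T-∨ down-x
... | inj₁ down₀ with down-elim n _ x down₀
...   | z , Gz , x⊆z = outside ∷ z , Gz , out⊆ x⊆z
down-elim (suc n) G (outside ∷ x) down-x | inj₂ down₁ with down-elim n _ x down₁
...   | z , Gz , x⊆z = inside ∷ z , Gz , out⊆ x⊆z

up-IsUp : ∀ n G → IsUp (up n G)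
up-IsUp n G x y x⊆y up-x with up-elim n G x up-x
... | z , Gz , z⊆x = up-intro n G z y Gz (⊆-trans z⊆x x⊆y)

down-IsDown : ∀ n G → IsDown (down n G)
down-IsDown n G x y x⊆y down-y with down-elim n G y down-y
... | z , Gz , y⊆z = down-intro n G z x Gz (⊆-trans x⊆y y⊆z)

Comparable : ∀ {n} → Subset n → Subset n → Set
Comparable x y = x ⊆ y ⊎ y ⊆ x

comparable-sym : ∀ {n} {x y : Subset n} → Comparable x y → Comparable y x
comparable-sym (inj₁ x⊆y) = inj₂ x⊆y
comparable-sym (inj₂ y⊆x) = inj₁ y⊆x

isolated : ∀ n → Fam n → Fam n
isolated n G x = not (down n G x) ∧ not (up n G x)

non-isolated : ∀ n G x → ¬ T (isolated n G x) → Σ (Subset n) λ z → T (G z) × Comparable x z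
non-isolated n G x ¬isolated with down n G x in down-x | up n G x in up-x
... | true | _ with down-elim n G x (subst T (sym down-x) _)
...   | z , Gz , x⊆z = z , Gz , inj₁ x⊆z
non-isolated n G x ¬isolated | false | true with up-elim n G x (subst T (sym up-x) _)
...   | z , Gz , z⊆x = z , Gz , inj₂ z⊆x
non-isolated n G x ¬isolated | false | false = ⊥-elim (¬isolated _)

am-gm : ∀ a b → 4 * (a * b) ≤ (a + b) * (a + b)
am-gm a b with ≤-total a b
... | inj₁ a≤b with m≤n⇒∃[o]m+o≡n a≤b
...   | d , refl = subst (4 * (a * (a + d)) ≤_) (sym (square a d)) (m≤m+n _ (d * d))
  where
  square : ∀ a d → (a + (a + d)) * (a + (a + d)) ≡ 4 * (a * (a + d)) + d * d
  square = solve-∀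
am-gm a b | inj₂ b≤a with m≤n⇒∃[o]m+o≡n b≤a
...   | d , refl = subst (4 * ((b + d) * b) ≤_) (sym (square b d)) (m≤m+n _ (d * d))
  where
  square : ∀ b d → ((b + d) + b) * ((b + d) + b) ≡ 4 * ((b + d) * b) + d * d
  square = solve-∀

product-bound : ∀ N g h a a' b b' → 1 ≤ N → a + a' ≡ N → b + b' ≡ N →
  N * g ≤ a * b → N * h ≤ a' * b' → 16 * (g * h) ≤ N * N
product-bound N g h a a' b b' N≥1 a+a' b+b' Ng≤ab Nh≤a'b' =
  *-cancelˡ-≤ (N * N) {{>-nonZero (*-mono-≤ N≥1 N≥1)}} (begin
    N * N * (16 * (g * h))          ≡⟨ regroup₁ N g h ⟩
    16 * ((N * g) * (N * h))        ≤⟨ *-monoʳ-≤ 16 (*-mono-≤ Ng≤ab Nh≤a'b') ⟩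
    16 * ((a * b) * (a' * b'))      ≡⟨ regroup₂ a b a' b' ⟩
    (4 * (a * a')) * (4 * (b * b')) ≤⟨ *-mono-≤ (am-gm a a') (am-gm b b') ⟩
    ((a + a') * (a + a')) * ((b + b') * (b + b')) ≡⟨ cong₂ (λ s t → (s * s) * (t * t)) a+a' b+b' ⟩
    (N * N) * (N * N)               ∎)
  where
  open ≤-Reasoning
  regroup₁ : ∀ N g h → N * N * (16 * (g * h)) ≡ 16 * ((N * g) * (N * h))
  regroup₁ = solve-∀
  regroup₂ : ∀ a b a' b' → 16 * ((a * b) * (a' * b')) ≡ (4 * (a * a')) * (4 * (b * b'))
  regroup₂ = solve-∀

quarter-bound : ∀ N g h → 16 * (g * h) ≤ N * N → N < 4 * g → 4 * h ≤ N
quarter-bound N g h 16gh≤N² N<4g with 4 * h ≤? N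
... | yes 4h≤N = 4h≤N
... | no  4h≰N = ⊥-elim (<⇒≱ (*-mono-< (n<1+n N) (n<1+n N)) (begin
  suc N * suc N        ≤⟨ *-mono-≤ N<4g (≰⇒> 4h≰N) ⟩
  (4 * g) * (4 * h)    ≡⟨ regroup g h ⟩
  16 * (g * h)         ≤⟨ 16gh≤N² ⟩
  N * N                ∎))
  where
  open ≤-Reasoning
  regroup : ∀ g h → (4 * g) * (4 * h) ≡ 16 * (g * h)
  regroup = solve-∀

-- A family with more than 2^n/4 members leaves at most 2^n/4 sets isolated.
-- (Harris–Kleitman for its up- and down-closures and for their complements.)
isolated-small : ∀ n (G : Fam n) → 2 ^ n < 4 * size n G → 4 * size n (isolated n G) ≤ 2 ^ n
isolated-small n G N<4G =
  quarter-bound (2 ^ n) (size n G) (size n (isolated n G))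
    (product-bound (2 ^ n) (size n G) (size n (isolated n G))
      (size n (up n G)) (size n (not ∘ up n G)) (size n (down n G)) (size n (not ∘ down n G))
      (m^n>0 2 n) (size-complement n (up n G)) (size-complement n (down n G))
      (≤-trans (*-monoʳ-≤ (2 ^ n) (size-mono n G⊆up∩down))
               (harris-kleitman n (up n G) (down n G) (up-IsUp n G) (down-IsDown n G)))
      (≤-trans (harris-kleitman n (not ∘ down n G) (not ∘ up n G)
                  (down-complement (down-IsDown n G)) (up-complement (up-IsUp n G)))
               (≤-reflexive (*-comm (size n (not ∘ down n G)) (size n (not ∘ up n G))))))
    N<4G
  where
  G⊆up∩down : ∀ x → T (G x) → T (up n G x ∧ down n G x)
  G⊆up∩down x Gx = from T-∧ (up-intro n G x x Gx ⊆-refl , down-intro n G x x Gx ⊆-refl)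

record Rainbow3 {n} (c : Coloring n 3) (x y z : Subset n) : Set where
  constructor rainbow
  field
    i j k : Fin 3
    cx : c x ≡ just i
    cy : c y ≡ just j
    cz : c z ≡ just k
    i≢j : i ≢ j
    i≢k : i ≢ k
    j≢k : j ≢ k

module _ {n} {c : Coloring n 3} where

  swap₁₂ : ∀ {x y z} → Rainbow3 c x y z → Rainbow3 c y x z
  swap₁₂ (rainbow i j k cx cy cz i≢j i≢k j≢k) = rainbow j i k cy cx cz (i≢j ∘ sym) j≢k i≢k

  swap₂₃ : ∀ {x y z} → Rainbow3 c x y z → Rainbow3 c x z y
  swap₂₃ (rainbow i j k cx cy cz i≢j i≢k j≢k) = rainbow i k j cx cz cy i≢k i≢j (j≢k ∘ sym)

  distinct₁₂ : ∀ {x y z} → Rainbow3 c x y z → x ≢ y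
  distinct₁₂ (rainbow i j k cx cy cz i≢j i≢k j≢k) refl = i≢j (just-injective (trans (sym cx) cy))

RainbowStar : ∀ {n} → Coloring n 3 → Set
RainbowStar {n} c = Σ (Subset n) λ x → Σ (Subset n) λ y → Σ (Subset n) λ z →
  Rainbow3 c x y z × Comparable x y × Comparable x z

triple : ∀ {a} {A : Set a} → A → A → A → Fin 3 → A
triple a b d zero             = a
triple a b d (suc zero)       = b
triple a b d (suc (suc zero)) = d

triple-injective : ∀ {a} {A : Set a} {x y z : A} → x ≢ y → x ≢ z → y ≢ z →
  ∀ p q → triple x y z p ≡ triple x y z q → p ≡ q
triple-injective x≢y x≢z y≢z zero             zero             _ = refl
triple-injective x≢y x≢z y≢z zero             (suc zero)       e = ⊥-elim (x≢y e)
triple-injective x≢y x≢z y≢z zero             (suc (suc zero)) e = ⊥-elim (x≢z e)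
triple-injective x≢y x≢z y≢z (suc zero)       zero             e = ⊥-elim (x≢y (sym e))
triple-injective x≢y x≢z y≢z (suc zero)       (suc zero)       _ = refl
triple-injective x≢y x≢z y≢z (suc zero)       (suc (suc zero)) e = ⊥-elim (y≢z e)
triple-injective x≢y x≢z y≢z (suc (suc zero)) zero             e = ⊥-elim (x≢z (sym e))
triple-injective x≢y x≢z y≢z (suc (suc zero)) (suc zero)       e = ⊥-elim (y≢z (sym e))
triple-injective x≢y x≢z y≢z (suc (suc zero)) (suc (suc zero)) _ = refl

both-hold : ∀ {n} {A : Set} {p q : Subset n} → A → p ⊆ q → A ⇔ (p ⊆ q)
both-hold a p⊆q = mk⇔ (λ _ {x} → p⊆q {x}) (λ _ → a)

both-fail : ∀ {n} {A : Set} {p q : Subset n} → ¬ A → ¬ (p ⊆ q) → A ⇔ (p ⊆ q)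
both-fail ¬a ¬p⊆q = mk⇔ (λ a {x} → ⊥-elim (¬a a)) (⊥-elim ∘ ¬p⊆q)

module _ {n} {c : Coloring n 3} {a b d : Subset n} (r : Rainbow3 c a b d) where
  open Rainbow3 r

  private
    a≢b = distinct₁₂ r
    a≢d = distinct₁₂ (swap₂₃ r)
    b≢d = distinct₁₂ (swap₂₃ (swap₁₂ r))

  rainbow-copy : (P : Poset 3) →
    (∀ p q → p ≢ q → P p q ⇔ (triple a b d p ⊆ triple a b d q)) → HasRainbowCopy c P
  rainbow-copy P order =
    triple a b d , (triple-injective a≢b a≢d b≢d , order) ,
    triple i j k , coloured , triple-injective i≢j i≢k j≢k
    where
    coloured : ∀ p → c (triple a b d p) ≡ just (triple i j k p)
    coloured zero             = cx
    coloured (suc zero)       = cy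
    coloured (suc (suc zero)) = cz

  rainbow-chain : a ⊆ b → b ⊆ d → HasRainbowCopy c P3
  rainbow-chain a⊆b b⊆d = rainbow-copy P3 order
    where
    order : ∀ p q → p ≢ q → P3 p q ⇔ (triple a b d p ⊆ triple a b d q)
    order zero             zero             p≢q = ⊥-elim (p≢q refl)
    order zero             (suc zero)       _   = both-hold z≤n a⊆b
    order zero             (suc (suc zero)) _   = both-hold z≤n (⊆-trans a⊆b b⊆d)
    order (suc zero)       zero             _   = both-fail (λ ()) (a≢b ∘ ⊆-antisym a⊆b)
    order (suc zero)       (suc zero)       p≢q = ⊥-elim (p≢q refl)
    order (suc zero)       (suc (suc zero)) _   = both-hold (s≤s z≤n) b⊆d
    order (suc (suc zero)) zero             _   = both-fail (λ ()) (a≢d ∘ ⊆-antisym (⊆-trans a⊆b b⊆d))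
    order (suc (suc zero)) (suc zero)       _   = both-fail (λ { (s≤s ()) }) (b≢d ∘ ⊆-antisym b⊆d)
    order (suc (suc zero)) (suc (suc zero)) p≢q = ⊥-elim (p≢q refl)

  rainbow-vee : a ⊆ b → a ⊆ d → ¬ b ⊆ d → ¬ d ⊆ b → HasRainbowCopy c vee2
  rainbow-vee a⊆b a⊆d b⊈d d⊈b = rainbow-copy vee2 order
    where
    order : ∀ p q → p ≢ q → vee2 p q ⇔ (triple a b d p ⊆ triple a b d q)
    order zero             zero             p≢q = ⊥-elim (p≢q refl)
    order zero             (suc zero)       _   = both-hold (inj₂ refl) a⊆b
    order zero             (suc (suc zero)) _   = both-hold (inj₂ refl) a⊆d
    order (suc zero)       zero             _   = both-fail (λ { (inj₁ ()) ; (inj₂ ()) }) (a≢b ∘ ⊆-antisym a⊆b)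
    order (suc zero)       (suc zero)       p≢q = ⊥-elim (p≢q refl)
    order (suc zero)       (suc (suc zero)) _   = both-fail (λ { (inj₁ ()) ; (inj₂ ()) }) b⊈d
    order (suc (suc zero)) zero             _   = both-fail (λ { (inj₁ ()) ; (inj₂ ()) }) (a≢d ∘ ⊆-antisym a⊆d)
    order (suc (suc zero)) (suc zero)       _   = both-fail (λ { (inj₁ ()) ; (inj₂ ()) }) d⊈b
    order (suc (suc zero)) (suc (suc zero)) p≢q = ⊥-elim (p≢q refl)

  rainbow-wedge : b ⊆ a → d ⊆ a → ¬ b ⊆ d → ¬ d ⊆ b → HasRainbowCopy c wedge2
  rainbow-wedge b⊆a d⊆a b⊈d d⊈b = rainbow-copy wedge2 order
    where
    order : ∀ p q → p ≢ q → wedge2 p q ⇔ (triple a b d p ⊆ triple a b d q)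
    order zero             zero             p≢q = ⊥-elim (p≢q refl)
    order zero             (suc zero)       _   = both-fail (λ { (inj₁ ()) ; (inj₂ ()) }) (a≢b ∘ flip ⊆-antisym b⊆a)
    order zero             (suc (suc zero)) _   = both-fail (λ { (inj₁ ()) ; (inj₂ ()) }) (a≢d ∘ flip ⊆-antisym d⊆a)
    order (suc zero)       zero             _   = both-hold (inj₂ refl) b⊆a
    order (suc zero)       (suc zero)       p≢q = ⊥-elim (p≢q refl)
    order (suc zero)       (suc (suc zero)) _   = both-fail (λ { (inj₁ ()) ; (inj₂ ()) }) b⊈d
    order (suc (suc zero)) zero             _   = both-hold (inj₂ refl) d⊆a
    order (suc (suc zero)) (suc zero)       _   = both-fail (λ { (inj₁ ()) ; (inj₂ ()) }) d⊈b
    order (suc (suc zero)) (suc (suc zero)) p≢q = ⊥-elim (p≢q refl)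

module _ {n} {c : Coloring n 3} where

  -- A rainbow star yields a rainbow ∧₂, ∨₂ or P₃: sort its three sets by inclusion.
  star-copy : RainbowStar c → HasRainbowCopy c wedge2 ⊎ HasRainbowCopy c vee2 ⊎ HasRainbowCopy c P3
  star-copy (x , y , z , r , inj₂ y⊆x , inj₂ z⊆x) with y ⊆? z | z ⊆? y
  ... | yes y⊆z | _       = inj₂ (inj₂ (rainbow-chain (swap₂₃ (swap₁₂ r)) y⊆z z⊆x))
  ... | no _    | yes z⊆y = inj₂ (inj₂ (rainbow-chain (swap₁₂ (swap₂₃ (swap₁₂ r))) z⊆y y⊆x))
  ... | no y⊈z  | no z⊈y  = inj₁ (rainbow-wedge r y⊆x z⊆x y⊈z z⊈y)
  star-copy (x , y , z , r , inj₁ x⊆y , inj₁ x⊆z) with y ⊆? z | z ⊆? y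
  ... | yes y⊆z | _       = inj₂ (inj₂ (rainbow-chain r x⊆y y⊆z))
  ... | no _    | yes z⊆y = inj₂ (inj₂ (rainbow-chain (swap₂₃ r) x⊆z z⊆y))
  ... | no y⊈z  | no z⊈y  = inj₂ (inj₁ (rainbow-vee r x⊆y x⊆z y⊈z z⊈y))
  star-copy (x , y , z , r , inj₂ y⊆x , inj₁ x⊆z) = inj₂ (inj₂ (rainbow-chain (swap₁₂ r) y⊆x x⊆z))
  star-copy (x , y , z , r , inj₁ x⊆y , inj₂ z⊆x) = inj₂ (inj₂ (rainbow-chain (swap₁₂ (swap₂₃ r)) z⊆x x⊆y))

  rainbow-at : ∀ {t : Fin 3 → Subset n} → IsRainbow c t → ∀ p q r → p ≢ q → p ≢ r → q ≢ r →
    Rainbow3 c (t p) (t q) (t r)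
  rainbow-at (κ , coloured , κ-injective) p q r p≢q p≢r q≢r =
    rainbow (κ p) (κ q) (κ r) (coloured p) (coloured q) (coloured r)
      (p≢q ∘ κ-injective p q) (p≢r ∘ κ-injective p r) (q≢r ∘ κ-injective q r)

  -- Conversely, every rainbow copy of ∧₂, ∨₂ or P₃ contains a rainbow star,
  -- centred at the middle of the chain, the bottom of ∨₂, the top of ∧₂.
  chain-star : HasRainbowCopy c P3 → RainbowStar c
  chain-star (t , (_ , order) , rb) =
    t (# 1) , t (# 0) , t (# 2) , rainbow-at rb (# 1) (# 0) (# 2) (λ ()) (λ ()) (λ ()) ,
    inj₂ (to (order (# 0) (# 1) (λ ())) z≤n) , inj₁ (to (order (# 1) (# 2) (λ ())) (s≤s z≤n))

  vee-star : HasRainbowCopy c vee2 → RainbowStar c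
  vee-star (t , (_ , order) , rb) =
    t (# 0) , t (# 1) , t (# 2) , rainbow-at rb (# 0) (# 1) (# 2) (λ ()) (λ ()) (λ ()) ,
    inj₁ (to (order (# 0) (# 1) (λ ())) (inj₂ refl)) , inj₁ (to (order (# 0) (# 2) (λ ())) (inj₂ refl))

  wedge-star : HasRainbowCopy c wedge2 → RainbowStar c
  wedge-star (t , (_ , order) , rb) =
    t (# 0) , t (# 1) , t (# 2) , rainbow-at rb (# 0) (# 1) (# 2) (λ ()) (λ ()) (λ ()) ,
    inj₂ (to (order (# 1) (# 0) (λ ())) (inj₂ refl)) , inj₂ (to (order (# 2) (# 0) (λ ())) (inj₂ refl))

Σ₃ : (Fin 3 → ℕ) → ℕ
Σ₃ f = f (# 0) + f (# 1) + f (# 2)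

Σ₃-term : ∀ f j → f j ≤ Σ₃ f
Σ₃-term f zero             = ≤-trans (m≤m+n (f (# 0)) (f (# 1))) (m≤m+n _ (f (# 2)))
Σ₃-term f (suc zero)       = ≤-trans (m≤n+m (f (# 1)) (f (# 0))) (m≤m+n _ (f (# 2)))
Σ₃-term f (suc (suc zero)) = m≤n+m (f (# 2)) _

Σ₃-mono : ∀ {f g} → (∀ j → f j ≤ g j) → Σ₃ f ≤ Σ₃ g
Σ₃-mono f≤g = +-mono-≤ (+-mono-≤ (f≤g (# 0)) (f≤g (# 1))) (f≤g (# 2))

Σ₃-mono-< : ∀ {f g} → (∀ j → f j < g j) → Σ₃ f < Σ₃ g
Σ₃-mono-< f<g = +-mono-< (+-mono-< (f<g (# 0)) (f<g (# 1))) (f<g (# 2))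

sumS-Σ₃ : ∀ n (f : Fin 3 → Subset n → ℕ) → sumS n (λ x → Σ₃ (λ j → f j x)) ≡ Σ₃ (λ j → sumS n (f j))
sumS-Σ₃ n f = trans (sumS-+ n _ _) (cong (_+ sumS n (f (# 2))) (sumS-+ n _ _))

T⇒1≤indicator : ∀ {b} → T b → 1 ≤ indicator b
T⇒1≤indicator {true} _ = ≤-refl

2^n≡4*2^[n∸2] : ∀ n → 2 ≤ n → 2 ^ n ≡ 4 * 2 ^ (n ∸ 2)
2^n≡4*2^[n∸2] (suc zero) (s≤s ())
2^n≡4*2^[n∸2] (suc (suc k)) _ = quadruple (2 ^ k)
  where
  quadruple : ∀ a → 2 * (2 * a) ≡ 4 * a
  quadruple = solve-∀

module _ {n} (c : Coloring n 3) where

  colourClass : Fin 3 → Fam n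
  colourClass j x = does (≡-decMaybe _≟ᶠ_ (c x) (just j))

  classSize-as-size : ∀ j → classSize c j ≡ size n (colourClass j)
  classSize-as-size j = count-as-sum n (λ x → ≡-decMaybe _≟ᶠ_ (c x) (just j))

  in-class : ∀ {x j} → T (colourClass j x) → c x ≡ just j
  in-class {x} {j} = accepted (≡-decMaybe _≟ᶠ_ (c x) (just j))
    where
    accepted : ∀ {A : Set} (a? : Dec A) → T (does a?) → A
    accepted (yes a) _ = a

module _ {n} (c : Coloring n 3) (no-star : ¬ RainbowStar c) where

  isolatedFrom : Fin 3 → Fam n
  isolatedFrom j = isolated n (colourClass c j)

  isolated-from-other : ∀ x {i} j k → c x ≡ just i → i ≢ j → i ≢ k → j ≢ k →
    T (isolatedFrom j x) ⊎ T (isolatedFrom k x)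
  isolated-from-other x {i} j k cx i≢j i≢k j≢k with T? (isolatedFrom j x) | T? (isolatedFrom k x)
  ... | yes isoⱼ | _        = inj₁ isoⱼ
  ... | no _     | yes isoₖ = inj₂ isoₖ
  ... | no ¬isoⱼ | no ¬isoₖ
    with non-isolated n (colourClass c j) x ¬isoⱼ | non-isolated n (colourClass c k) x ¬isoₖ
  ...   | y , y∈j , x~y | z , z∈k , x~z =
    ⊥-elim (no-star (x , y , z , rainbow i j k cx (in-class c y∈j) (in-class c z∈k) i≢j i≢k j≢k , x~y , x~z))

  isolation-counts : ∀ {x j k} → T (isolatedFrom j x) ⊎ T (isolatedFrom k x) →
    1 ≤ Σ₃ (λ j → indicator (isolatedFrom j x))
  isolation-counts {x} {j}     (inj₁ isoⱼ) =
    ≤-trans (T⇒1≤indicator isoⱼ) (Σ₃-term (λ j → indicator (isolatedFrom j x)) j)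
  isolation-counts {x} {k = k} (inj₂ isoₖ) =
    ≤-trans (T⇒1≤indicator isoₖ) (Σ₃-term (λ j → indicator (isolatedFrom j x)) k)

  coloured≤isolated : ∀ x →
    Σ₃ (λ j → indicator (colourClass c j x)) ≤ Σ₃ (λ j → indicator (isolatedFrom j x))
  coloured≤isolated x with c x in cx
  ... | nothing               = z≤n
  ... | just zero             = isolation-counts (isolated-from-other x (# 1) (# 2) cx (λ ()) (λ ()) (λ ()))
  ... | just (suc zero)       = isolation-counts (isolated-from-other x (# 0) (# 2) cx (λ ()) (λ ()) (λ ()))
  ... | just (suc (suc zero)) = isolation-counts (isolated-from-other x (# 0) (# 1) cx (λ ()) (λ ()) (λ ()))

  classes≤isolated : Σ₃ (λ j → size n (colourClass c j)) ≤ Σ₃ (λ j → size n (isolatedFrom j))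
  classes≤isolated =
    subst₂ _≤_ (sumS-Σ₃ n (λ j → indicator ∘ colourClass c j)) (sumS-Σ₃ n (λ j → indicator ∘ isolatedFrom j))
      (sumS-mono n coloured≤isolated)

  upper-bound : 2 ≤ n → ∀ m → (∀ j → m ≤ classSize c j) → m ≤ 2 ^ (n ∸ 2)
  upper-bound 2≤n m large with m ≤? 2 ^ (n ∸ 2)
  ... | yes m≤K = m≤K
  ... | no  m≰K = ⊥-elim (<⇒≱ (Σ₃-mono-< (λ _ → n<1+n K)) (begin
    Σ₃ (λ _ → suc K)                    ≤⟨ Σ₃-mono (λ j → ≤-trans (≰⇒> m≰K) (large′ j)) ⟩
    Σ₃ (λ j → size n (colourClass c j)) ≤⟨ classes≤isolated ⟩
    Σ₃ (λ j → size n (isolatedFrom j))  ≤⟨ Σ₃-mono isolated≤K ⟩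
    Σ₃ (λ _ → K)                        ∎))
    where
    open ≤-Reasoning
    K = 2 ^ (n ∸ 2)
    large′ : ∀ j → m ≤ size n (colourClass c j)
    large′ j = subst (m ≤_) (classSize-as-size c j) (large j)
    -- every class exceeds K, so by isolated-small it isolates at most K sets
    isolated≤K : ∀ j → size n (isolatedFrom j) ≤ K
    isolated≤K j = *-cancelˡ-≤ 4 (subst (4 * size n (isolatedFrom j) ≤_) (2^n≡4*2^[n∸2] n 2≤n)
      (isolated-small n (colourClass c j)
        (subst (_< 4 * size n (colourClass c j)) (sym (2^n≡4*2^[n∸2] n 2≤n))
          (*-monoʳ-< 4 (<-≤-trans (≰⇒> m≰K) (large′ j))))))

next : Fin 3 → Fin 3
next zero             = suc zero
next (suc zero)       = suc (suc zero)
next (suc (suc zero)) = zero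

next³ : ∀ i → next (next (next i)) ≡ i
next³ zero             = refl
next³ (suc zero)       = refl
next³ (suc (suc zero)) = refl

other-colour : ∀ {i j} → i ≢ j → j ≡ next i ⊎ j ≡ next (next i)
other-colour {zero}             {zero}             i≢j = ⊥-elim (i≢j refl)
other-colour {zero}             {suc zero}         _   = inj₁ refl
other-colour {zero}             {suc (suc zero)}   _   = inj₂ refl
other-colour {suc zero}         {zero}             _   = inj₂ refl
other-colour {suc zero}         {suc zero}         i≢j = ⊥-elim (i≢j refl)
other-colour {suc zero}         {suc (suc zero)}   _   = inj₁ refl
other-colour {suc (suc zero)}   {zero}             _   = inj₁ refl
other-colour {suc (suc zero)}   {suc zero}         _   = inj₂ refl
other-colour {suc (suc zero)}   {suc (suc zero)}   i≢j = ⊥-elim (i≢j refl)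

next≢next² : ∀ i → next i ≢ next (next i)
next≢next² zero             ()
next≢next² (suc zero)       ()
next≢next² (suc (suc zero)) ()

other-colours : ∀ {i j k} → i ≢ j → i ≢ k → j ≢ k →
  (j ≡ next i × k ≡ next (next i)) ⊎ (k ≡ next i × j ≡ next (next i))
other-colours i≢j i≢k j≢k with other-colour i≢j | other-colour i≢k
... | inj₁ refl | inj₁ refl = ⊥-elim (j≢k refl)
... | inj₁ refl | inj₂ refl = inj₁ (refl , refl)
... | inj₂ refl | inj₁ refl = inj₂ (refl , refl)
... | inj₂ refl | inj₂ refl = ⊥-elim (j≢k refl)

-- A pattern p ∈ B₃ gets colour i when i ∈ p and its cyclic predecessor is not;
-- ∅ and [3] stay uncoloured, and each colour is used by exactly two patterns.
pattern-colour : Subset 3 → Maybe (Fin 3)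
pattern-colour (outside ∷ outside ∷ outside ∷ []) = nothing
pattern-colour (outside ∷ outside ∷ inside  ∷ []) = just (# 2)
pattern-colour (outside ∷ inside  ∷ outside ∷ []) = just (# 1)
pattern-colour (outside ∷ inside  ∷ inside  ∷ []) = just (# 1)
pattern-colour (inside  ∷ outside ∷ outside ∷ []) = just (# 0)
pattern-colour (inside  ∷ outside ∷ inside  ∷ []) = just (# 2)
pattern-colour (inside  ∷ inside  ∷ outside ∷ []) = just (# 0)
pattern-colour (inside  ∷ inside  ∷ inside  ∷ []) = nothing

pattern-colour-spec : ∀ p {i} → pattern-colour p ≡ just i → i ∈ p × ¬ (next (next i) ∈ p)
pattern-colour-spec (outside ∷ outside ∷ inside  ∷ []) refl = there (there here) , λ { (there ()) }
pattern-colour-spec (outside ∷ inside  ∷ outside ∷ []) refl = there here , λ ()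
pattern-colour-spec (outside ∷ inside  ∷ inside  ∷ []) refl = there here , λ ()
pattern-colour-spec (inside  ∷ outside ∷ outside ∷ []) refl = here , λ { (there (there ())) }
pattern-colour-spec (inside  ∷ outside ∷ inside  ∷ []) refl = there (there here) , λ { (there ()) }
pattern-colour-spec (inside  ∷ inside  ∷ outside ∷ []) refl = here , λ { (there (there ())) }

take-⊆ : ∀ m {k} {x y : Subset (m + k)} → x ⊆ y → take m x ⊆ take m y
take-⊆ zero    x⊆y ()
take-⊆ (suc m) {x = outside ∷ x} {_ ∷ y}       x⊆y = out⊆ (take-⊆ m (drop-∷-⊆ x⊆y))
take-⊆ (suc m) {x = inside ∷ x}  {inside ∷ y}  x⊆y = in⊆in (take-⊆ m (drop-∷-⊆ x⊆y))
take-⊆ (suc m) {x = inside ∷ x}  {outside ∷ y} x⊆y = ⊥-elim (zero∉outside∷ (x⊆y here))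

extremal : ∀ k → Coloring (3 + k) 3
extremal k x = pattern-colour (take 3 x)

module _ {k : ℕ} where

  descends : ∀ {x y : Subset (3 + k)} {i} → extremal k x ≡ just i → extremal k y ≡ just (next i) →
    Comparable x y → y ⊆ x
  descends _ _ (inj₂ y⊆x) = y⊆x
  descends {x} {y} {i} cx cy (inj₁ x⊆y) with pattern-colour-spec (take 3 x) cx | pattern-colour-spec (take 3 y) cy
  ... | i∈x , _ | _ , prev∉y = ⊥-elim (prev∉y (subst (_∈ take 3 y) (sym (next³ i)) (take-⊆ 3 x⊆y i∈x)))

  -- A set of colour i cannot be comparable to sets of colours next i and next (next i):
  -- these would satisfy v ⊆ x ⊆ w ⊆ v, forcing v = w.
  no-cycle : ∀ {x v w : Subset (3 + k)} {i} → extremal k x ≡ just i →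
    extremal k v ≡ just (next i) → extremal k w ≡ just (next (next i)) →
    Comparable x v → Comparable x w → ⊥
  no-cycle {x} {v} {w} {i} cx cv cw x~v x~w = next≢next² i (just-injective (begin
    just (next i)          ≡⟨ sym cv ⟩
    extremal k v           ≡⟨ cong (extremal k) (⊆-antisym v⊆w w⊆v) ⟩
    extremal k w           ≡⟨ cw ⟩
    just (next (next i))   ∎))
    where
    open ≡-Reasoning
    v⊆x : v ⊆ x
    v⊆x = descends cx cv x~v
    x⊆w : x ⊆ w
    x⊆w = descends cw (trans cx (sym (cong just (next³ i)))) (comparable-sym x~w)
    v⊆w : v ⊆ w
    v⊆w = ⊆-trans v⊆x x⊆w
    w⊆v : w ⊆ v
    w⊆v = descends cv cw (inj₁ v⊆w)

  extremal-no-star : ¬ RainbowStar (extremal k)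
  extremal-no-star (x , y , z , rainbow i j l cx cy cz i≢j i≢l j≢l , x~y , x~z)
    with other-colours i≢j i≢l j≢l
  ... | inj₁ (refl , refl) = no-cycle cx cy cz x~y x~z
  ... | inj₂ (refl , refl) = no-cycle cx cz cy x~z x~y

  -- Each colour is used by two of the eight patterns, hence by 2 · 2^k sets.
  extremal-classSize : ∀ i → classSize (extremal k) i ≡ 2 ^ suc k
  extremal-classSize i =
    trans (classSize-as-size (extremal k) i)
          (trans (sumS-take 3 k (λ p → indicator (does (≡-decMaybe _≟ᶠ_ (pattern-colour p) (just i)))))
                 (cong (_* 2 ^ k) (two-patterns i)))
    where
    two-patterns : ∀ i → sumS 3 (λ p → indicator (does (≡-decMaybe _≟ᶠ_ (pattern-colour p) (just i)))) ≡ 2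
    two-patterns zero             = refl
    two-patterns (suc zero)       = refl
    two-patterns (suc (suc zero)) = refl

no-copy-no-star : ∀ {n} (c : Coloring n 3) → ¬ HasRainbowCopy c wedge2 → ¬ HasRainbowCopy c vee2 →
  ¬ HasRainbowCopy c P3 → ¬ RainbowStar c
no-copy-no-star c no-wedge no-vee no-chain = [ no-wedge , [ no-vee , no-chain ] ] ∘ star-copy

extremal-admissible : ∀ k → Admissible (3 + k) 3 (2 ^ suc k)
extremal-admissible k =
  extremal k , extremal-no-star ∘ wedge-star , extremal-no-star ∘ vee-star , extremal-no-star ∘ chain-star ,
  λ i → ≤-reflexive (sym (extremal-classSize {k} i))

theorem3 : (n : ℕ) → n ≥ 3 → fIs n 3 (2 ^ (n ∸ 2))
theorem3 zero                 ()
theorem3 (suc zero)           (s≤s ())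
theorem3 (suc (suc zero))     (s≤s (s≤s ()))
theorem3 (suc (suc (suc k))) _ =
  extremal-admissible k ,
  λ { m (c , no-wedge , no-vee , no-chain , large) →
        upper-bound c (no-copy-no-star c no-wedge no-vee no-chain) (s≤s (s≤s z≤n)) m large }
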